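{- Let $m\ge 2$ and $v=(-\tfrac1m,-\tfrac2m,\ldots,-\tfrac{m-1}{m})\in\mathbb R^{m-1}$. Then the Kunz polyhedron satisfies $P_m=\mathcal C(\mathbb Z_m)+v$, i.e. $P_m$ is a translation of the group cone $\mathcal C(\mathbb Z_m)$. Moreover, if $F$ is a face of $P_m$ and $S$ is a numerical semigroup containing $m$ whose Kunz coordinate vector $\mathrm{KV}_m(S)$ lies in the relative interior of $F$, then the Kunz poset $\mathcal A(S;m)$ of $S$ equals the Kunz poset of the face $F-v$ of $\mathcal C(\mathbb Z_m)$.
   Context: A numerical semigroup is a subset $S\subseteq\mathbb Z_{\ge0}$ closed under addition with finite complement. For $m\in S$, $m\ge1$, the Apéry set is $\mathrm{Ap}(S;m)=\{s\in S: s-m\notin S\}=\{0,a_1,\ldots,a_{m-1}\}$ where $a_i\equiv i\pmod m$ is the least element of $S$ in its residue class; writing $a_i=k_im+i$, the Kunz coordinate vector is $\mathrm{KV}_m(S)=(k_1,\ldots,k_{m-1})$. The Kunz poset $\mathcal A(S;m)$ is the poset on $\mathbb Z_m$ with $i\preceq j$ iff $a_j-a_i\in S$ (with $a_0=0$). The Kunz polyhedron $P_m\subset\mathbb R^{m-1}$ is the set of $z$ with $z_i+z_j\ge z_{i+j}$ for $1\le i\le j\le m-1$, $i+j<m$, and $z_i+z_j+1\ge z_{i+j-m}$ for $1\le i\le j\le m-1$, $i+j>m$. For a finite abelian group $G$, the group cone $\mathcal C(G)\subset\mathbb R^{|G|-1}$ (coordinates indexed by $G\setminus\{0\}$) is the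 set of $x$ with $x_a+x_b\ge x_{a+b}$ for all nonzero $a,b$ with $a+b\ne0$; here $G=\mathbb Z_m$ with coordinates indexed by $1,\ldots,m-1$. For a face $F'$ of $\mathcal C(G)$, its Kunz subgroup is $H=\{0\}\cup\{h\ne0: x_h=0\ \forall x\in F'\}$, and its Kunz poset is the partial order $\preceq$ on $G/H$ (it exists and is Kunz-balanced) such that for all nonzero $a,b$ with $a+b\neq0$: $x_a+x_b=x_{a+b}$ for all $x\in F'$ iff $\bar a\preceq\bar a+\bar b$, where bars denote images in $G/H$.
   Formalization: The Kunz polyhedron $P_m$, the group cone $\mathcal C(\mathbb Z_m)$, their faces and relative interiors are taken over ℚ^(m-1) instead of $\mathbb R^{m-1}$. -}

module Defs where

open import Data.Nat as ℕ using (ℕ; zero; suc; _≤_; _<_; _∸_; NonZero)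
open import Data.Nat.DivMod using (_%_)
open import Data.Integer using (+_)
open import Data.Rational as ℚ using (ℚ; 1ℚ; _/_; -_)
open import Data.Product using (Σ; _×_)
open import Data.Sum using (_⊎_)
open import Relation.Binary.PropositionalEquality using (_≡_; _≢_)
open import Relation.Nullary using (¬_)
open import Function.Bundles using (_⇔_)

-- Points of ℝ^{m-1} are represented (over ℚ) as functions
-- ℕ → ℚ; only the coordinates 1,…,m-1 are ever used.
Pt : Set
Pt = ℕ → ℚ

ofℕ : ℕ → ℚ
ofℕ n = + n / 1

InRange : ℕ → ℕ → Set
InRange m i = 1 ≤ i × i < m

ValidP : ℕ → ℕ → ℕ → Set
ValidP m i j = 1 ≤ i × i ≤ j × j < m × (i ℕ.+ j < m ⊎ m < i ℕ.+ j)

SatP : ℕ → Pt → ℕ → ℕ → Set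
SatP m z i j = (i ℕ.+ j < m × z (i ℕ.+ j) ℚ.≤ z i ℚ.+ z j)
             ⊎ (m < i ℕ.+ j × z (i ℕ.+ j ∸ m) ℚ.≤ z i ℚ.+ z j ℚ.+ 1ℚ)

TightP : ℕ → Pt → ℕ → ℕ → Set
TightP m z i j = (i ℕ.+ j < m × z i ℚ.+ z j ≡ z (i ℕ.+ j))
               ⊎ (m < i ℕ.+ j × z i ℚ.+ z j ℚ.+ 1ℚ ≡ z (i ℕ.+ j ∸ m))

InKunzPolyhedron : ℕ → Pt → Set
InKunzPolyhedron m z = ∀ i j → ValidP m i j → SatP m z i j

-- residue mod m (m ≥ 2 in the theorem; the m = 0 clause is junk)
_mod_ : ℕ → ℕ → ℕ
n mod zero    = n
n mod (suc k) = n % suc k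

ValidC : ℕ → ℕ → ℕ → Set
ValidC m a b = InRange m a × InRange m b × (a ℕ.+ b) mod m ≢ 0

InGroupCone : ℕ → Pt → Set
InGroupCone m x = ∀ a b → ValidC m a b → x ((a ℕ.+ b) mod m) ℚ.≤ x a ℚ.+ x b

TightC : ℕ → Pt → ℕ → ℕ → Set
TightC m x a b = x a ℚ.+ x b ≡ x ((a ℕ.+ b) mod m)

-- Faces (of polyhedra given by these inequality descriptions):
-- a face is the set of points of the polyhedron at which some chosen
-- subset T of the defining inequalities holds with equality.

IsFaceP : ℕ → (Pt → Set) → Set₁
IsFaceP m F = Σ (ℕ → ℕ → Set) λ T →
  ∀ z → F z ⇔ (InKunzPolyhedron m z × (∀ i j → ValidP m i j → T i j → TightP m z i j))

IsFaceC : ℕ → (Pt → Set) → Set₁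
IsFaceC m F = Σ (ℕ → ℕ → Set) λ T →
  ∀ x → F x ⇔ (InGroupCone m x × (∀ a b → ValidC m a b → T a b → TightC m x a b))

-- relative interior of a face F of P_m: points of F at which every
-- defining inequality that is not an equality on all of F is strict.
InRelIntP : ℕ → (Pt → Set) → Pt → Set
InRelIntP m F z = F z ×
  (∀ i j → ValidP m i j → TightP m z i j → ∀ z' → F z' → TightP m z' i j)

vecV : ℕ → Pt
vecV zero    i = ℚ.0ℚ
vecV (suc k) i = - (+ i / suc k)

translate : Pt → Pt → Pt
translate z w i = z i ℚ.+ w i

shiftFace : ℕ → (Pt → Set) → (Pt → Set)
shiftFace m F x = F (translate x (vecV m))

record IsNumericalSemigroup (S : ℕ → Set) : Set where
  field
    zero∈   : S 0
    +-closed : ∀ a b → S a → S b → S (a ℕ.+ b)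
    cofinite : Σ ℕ λ N → ∀ n → N ≤ n → S n

-- k is the i-th Kunz coordinate of S w.r.t. m: a_i = k m + i is the
-- least element of S congruent to i mod m.
IsKunzCoord : (S : ℕ → Set) → ℕ → ℕ → ℕ → Set
IsKunzCoord S m i k = S (k ℕ.* m ℕ.+ i) × (∀ k' → k' < k → ¬ S (k' ℕ.* m ℕ.+ i))

IsKunzVector : (S : ℕ → Set) → ℕ → (ℕ → ℕ) → Set
IsKunzVector S m kv = ∀ i → InRange m i → IsKunzCoord S m i (kv i)

aperyElt : ℕ → (ℕ → ℕ) → ℕ → ℕ
aperyElt m kv zero    = 0
aperyElt m kv (suc i) = kv (suc i) ℕ.* m ℕ.+ suc i

KunzPosetS : (S : ℕ → Set) → ℕ → (ℕ → ℕ) → ℕ → ℕ → Set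
KunzPosetS S m kv i j = aperyElt m kv i ≤ aperyElt m kv j
                      × S (aperyElt m kv j ∸ aperyElt m kv i)

InKunzSubgroupNZ : ℕ → (Pt → Set) → ℕ → Set
InKunzSubgroupNZ m F' h = InRange m h × (∀ x → F' x → x h ≡ ℚ.0ℚ)

-- The defining property of the Kunz poset of F' in the case of trivial
-- Kunz subgroup (so G/H = ℤ_m): for nonzero a,b with a+b ≠ 0,
-- x_a + x_b = x_{a+b} on F'  iff  a ⪯ a+b.
IsKunzPosetOfFace : ℕ → (Pt → Set) → (ℕ → ℕ → Set) → Set
IsKunzPosetOfFace m F' R =
  (∀ h → ¬ InKunzSubgroupNZ m F' h) ×
  (∀ a b → ValidC m a b → ((∀ x → F' x → TightC m x a b) ⇔ R a ((a ℕ.+ b) mod m)))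

minusV : ℕ → Pt → Pt
minusV m z i = z i ℚ.- vecV m i

{-# OPTIONS --safe #-}
-- Put x = z − v, i.e. x_i = z_i + i/m.  Since i/m + j/m = ((i + j) mod m)/m + c with a carry
-- c ∈ {0, 1}, the inequality of P_m indexed by (i, j) and the cone inequality
-- x_{i+j} ≤ x_i + x_j differ by the same constant on both sides, so they hold, and are tight, at
-- the same points: translation by v maps P_m onto C(ℤ_m) and faces onto faces.
-- At the Kunz vector of S the translated point is x_i = a_i/m, a_i the Apéry elements.  So
-- x_h = a_h/m > 0 (the Kunz subgroup is trivial), and x_a + x_b = x_{a+b} says a_a + a_b = a_{a+b},
-- which is equivalent to a_{a+b} − a_a ∈ S: that difference lies in S and is congruent to b, so it
-- is at least a_b, while a_a + a_b lies in S and is congruent to a + b, so it is at least a_{a+b}.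
-- Finally, the point lies in the relative interior of F, so an equality holds on all of F − v
-- exactly when it holds there.
module Submission where

open import Defs
open import Data.Nat as ℕ using (ℕ; suc; _+_; _*_; _∸_; _≤_; _<_; z≤n; s≤s)
open import Data.Nat.Properties
  using ( ≤-total; ≤-trans; ≤-antisym; ≤-<-trans; <⇒≤; <⇒≢; <⇒≯; ≮⇒≥; ≰⇒>; _≤?_; <-cmp
        ; +-comm; *-identityˡ; *-identityʳ; +-cancelʳ-≡; +-cancelˡ-≡; +-mono-<
        ; +-monoʳ-≤; +-monoʳ-<; *-monoˡ-≤; m≤m+n; m≤n+m; m+n∸m≡n; m+[n∸m]≡n
        ; m≤n⇒∃[o]m+o≡n; m<n+o⇒m∸n<o; m<n⇒0<n∸m; n≢0⇒n>0; module ≤-Reasoning )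
open import Data.Nat.DivMod using (m≡m%n+[m/n]*n; m%n<n; n%n≡0; m<n⇒m%n≡m; m≤n⇒[n∸m]%m≡n%m)
open import Data.Nat.Tactic.RingSolver using (solve)
open import Data.Integer as ℤ using (+_)
import Data.Integer.Properties as ℤₚ
open import Data.Rational as ℚ using (ℚ; 1ℚ; _/_; -_; fromℚᵘ)
import Data.Rational.Properties as ℚₚ
open import Data.Rational.Unnormalised as ℚᵘ using (mkℚᵘ; *≡*)
import Data.Rational.Unnormalised.Properties as ℚᵘₚ
open import Algebra.Bundles using (CommutativeMonoid)
import Algebra.Properties.AbelianGroup as AbelianGroupProperties
import Algebra.Properties.CommutativeSemigroup as CommutativeSemigroupProperties
open import Data.List using (_∷_; [])
open import Data.Product using (∃; _×_; _,_; proj₁; proj₂)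
open import Data.Product.Function.NonDependent.Propositional using (_×-⇔_)
open import Data.Sum using (_⊎_; inj₁; inj₂; [_,_])
open import Relation.Binary.Definitions using (Tri; tri<; tri≈; tri>)
open import Relation.Binary.PropositionalEquality
  using (_≡_; _≢_; refl; sym; trans; cong; cong₂; subst; subst₂; module ≡-Reasoning)
open import Relation.Nullary using (¬_; yes; no; contradiction)
open import Function.Bundles using (_⇔_; mk⇔; Equivalence)
open import Function.Construct.Identity using (⇔-id)
open import Function.Construct.Symmetry using (⇔-sym)
open import Function.Construct.Composition using (_⇔-∘_)

open Equivalence using (to; from)

private
  module ℚ+ = AbelianGroupProperties ℚₚ.+-0-abelianGroup
  module ℚ+-comm = CommutativeSemigroupProperties
                     (CommutativeMonoid.commutativeSemigroup ℚₚ.+-0-commutativeMonoid)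

×⊎×-selectˡ : ∀ {A B P Q : Set} → A → ¬ B → (A × P ⊎ B × Q) ⇔ P
×⊎×-selectˡ a ¬b = mk⇔ [ proj₂ , (λ (b , _) → contradiction b ¬b) ] (λ p → inj₁ (a , p))

×⊎×-selectʳ : ∀ {A B P Q : Set} → ¬ A → B → (A × P ⊎ B × Q) ⇔ Q
×⊎×-selectʳ ¬a b = mk⇔ [ (λ (a , _) → contradiction a ¬a) , proj₂ ] (λ q → inj₂ (b , q))

fromℚᵘ-homo-+ : ∀ p q → fromℚᵘ (p ℚᵘ.+ q) ≡ fromℚᵘ p ℚ.+ fromℚᵘ q
fromℚᵘ-homo-+ p q = ℚₚ.toℚᵘ-injective (ℚᵘₚ.≃-trans (ℚₚ.toℚᵘ-fromℚᵘ (p ℚᵘ.+ q))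
  (ℚᵘₚ.≃-trans (ℚᵘₚ.+-cong (ℚᵘₚ.≃-sym (ℚₚ.toℚᵘ-fromℚᵘ p)) (ℚᵘₚ.≃-sym (ℚₚ.toℚᵘ-fromℚᵘ q)))
               (ℚᵘₚ.≃-sym (ℚₚ.toℚᵘ-homo-+ (fromℚᵘ p) (fromℚᵘ q)))))

fraction-sum : ∀ a b c p q r → (a * suc q + b * suc p) * suc r ≡ c * (suc p * suc q) →
               + a / suc p ℚ.+ + b / suc q ≡ + c / suc r
fraction-sum a b c p q r eq = begin
  + a / suc p ℚ.+ + b / suc q              ≡⟨ fromℚᵘ-homo-+ A B ⟨
  fromℚᵘ (A ℚᵘ.+ B)                        ≡⟨ ℚₚ.fromℚᵘ-cong {A ℚᵘ.+ B} {mkℚᵘ (+ c) r} (*≡* cross) ⟩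
  + c / suc r                              ∎
  where
  open ≡-Reasoning
  A = mkℚᵘ (+ a) p
  B = mkℚᵘ (+ b) q
  cross : (+ a ℤ.* + suc q ℤ.+ + b ℤ.* + suc p) ℤ.* + suc r ≡ + c ℤ.* + (suc p * suc q)
  cross = begin
    (+ a ℤ.* + suc q ℤ.+ + b ℤ.* + suc p) ℤ.* + suc r
      ≡⟨ cong (ℤ._* + suc r) (cong₂ ℤ._+_ (ℤₚ.pos-* a (suc q)) (ℤₚ.pos-* b (suc p))) ⟨
    (+ (a * suc q) ℤ.+ + (b * suc p)) ℤ.* + suc r
      ≡⟨ cong (ℤ._* + suc r) (ℤₚ.pos-+ (a * suc q) (b * suc p)) ⟨
    + (a * suc q + b * suc p) ℤ.* + suc r  ≡⟨ ℤₚ.pos-* (a * suc q + b * suc p) (suc r) ⟨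
    + ((a * suc q + b * suc p) * suc r)    ≡⟨ cong +_ eq ⟩
    + (c * (suc p * suc q))                ≡⟨ ℤₚ.pos-* c (suc p * suc q) ⟩
    + c ℤ.* + (suc p * suc q)              ∎

≤-shift⇔ : ∀ {p q t X Y} → X ≡ p ℚ.+ t → Y ≡ q ℚ.+ t → (p ℚ.≤ q) ⇔ (X ℚ.≤ Y)
≤-shift⇔ {p} {q} {t} refl refl = mk⇔ (ℚₚ.+-monoˡ-≤ t)
  (λ le → subst₂ ℚ._≤_ (ℚ+.//-rightDividesʳ t p) (ℚ+.//-rightDividesʳ t q)
                         (ℚₚ.+-monoˡ-≤ (- t) le))

≡-shift⇔ : ∀ {p q t X Y} → X ≡ p ℚ.+ t → Y ≡ q ℚ.+ t → (p ≡ q) ⇔ (X ≡ Y)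
≡-shift⇔ {p} {q} {t} refl refl = mk⇔ (cong (ℚ._+ t)) (ℚ+.∙-cancelʳ t p q)

q*m+r≡p*m+s⇒∃[d] : ∀ {m p q r s} → r < m → q * m + r ≡ p * m + s →
                   ∃ λ d → p + d ≡ q × s ≡ d * m + r
q*m+r≡p*m+s⇒∃[d] {m} {p} {q} {r} {s} r<m eq with p ≤? q
... | no p≰q = contradiction eq (<⇒≢ (begin-strict
  q * m + r  <⟨ +-monoʳ-< (q * m) r<m ⟩
  q * m + m  ≡⟨ +-comm (q * m) m ⟩
  suc q * m  ≤⟨ *-monoˡ-≤ m (≰⇒> p≰q) ⟩
  p * m      ≤⟨ m≤m+n (p * m) s ⟩
  p * m + s  ∎))
  where open ≤-Reasoning
... | yes p≤q with m≤n⇒∃[o]m+o≡n p≤q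
...   | d , refl = d , refl , +-cancelˡ-≡ (p * m) s (d * m + r) (begin
  p * m + s            ≡⟨ eq ⟨
  (p + d) * m + r      ≡⟨ solve (p ∷ d ∷ m ∷ r ∷ []) ⟩
  p * m + (d * m + r)  ∎)
  where open ≡-Reasoning

kunzCoord-least : ∀ {S m i k p q s} → IsKunzCoord S m i k → i < m → S s →
                  q * m + i ≡ p * m + s → p + k ≤ q
kunzCoord-least {m = m} {p = p} {q} (_ , minimal) i<m s∈S eq
  with q*m+r≡p*m+s⇒∃[d] {m} {p} {q} i<m eq
... | d , refl , refl = +-monoʳ-≤ p (≮⇒≥ (λ d<k → minimal d d<k s∈S))

module _ {S : ℕ → Set} (S-closed : ∀ s t → S s → S t → S (s + t)) {m : ℕ} where

  kunzCoord-sum⇔ : ∀ {a b c e ka kb kc} →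
    IsKunzCoord S m a ka → IsKunzCoord S m b kb → IsKunzCoord S m c kc →
    b < m → c < m → a + b ≡ c + e * m →
    ((ka * m + a) + (kb * m + b) ≡ kc * m + c)
      ⇔ (ka * m + a ≤ kc * m + c × S (kc * m + c ∸ (ka * m + a)))
  kunzCoord-sum⇔ {a} {b} {c} {e} {ka} {kb} {kc} (a∈S , _) b-coord@(b∈S , _) c-coord b<m c<m a+b≡ =
    mk⇔ poset λ (le , s∈S) →
      trans sum≡ (cong (λ k → k * m + c) (sym (kc≡e+ka+kb s∈S (m+[n∸m]≡n le))))
    where
    open ≡-Reasoning
    poset : (ka * m + a) + (kb * m + b) ≡ kc * m + c →
            ka * m + a ≤ kc * m + c × S (kc * m + c ∸ (ka * m + a))
    poset eq = subst (ka * m + a ≤_) eq (m≤m+n _ _)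
             , subst S (trans (sym (m+n∸m≡n (ka * m + a) (kb * m + b))) (cong (_∸ (ka * m + a)) eq))
                       b∈S
    sum≡ : (ka * m + a) + (kb * m + b) ≡ (e + ka + kb) * m + c
    sum≡ = begin
      (ka * m + a) + (kb * m + b)  ≡⟨ solve (ka ∷ kb ∷ m ∷ a ∷ b ∷ []) ⟩
      (ka + kb) * m + (a + b)      ≡⟨ cong (_+_ ((ka + kb) * m)) a+b≡ ⟩
      (ka + kb) * m + (c + e * m)  ≡⟨ solve (ka ∷ kb ∷ m ∷ c ∷ e ∷ []) ⟩
      (e + ka + kb) * m + c        ∎
    kc≡e+ka+kb : ∀ {s} → S s → (ka * m + a) + s ≡ kc * m + c → kc ≡ e + ka + kb
    kc≡e+ka+kb {s} s∈S hs = ≤-antisym upper lower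
      where
      upper : kc ≤ e + ka + kb
      upper = kunzCoord-least {S} c-coord c<m (S-closed _ _ a∈S b∈S) (sym sum≡)
      shifted : kc * m + b ≡ (e + ka) * m + s
      shifted = +-cancelʳ-≡ c _ _ (begin
        (kc * m + b) + c             ≡⟨ solve (kc ∷ m ∷ b ∷ c ∷ []) ⟩
        (kc * m + c) + b             ≡⟨ cong (_+ b) hs ⟨
        ((ka * m + a) + s) + b       ≡⟨ solve (ka ∷ m ∷ a ∷ s ∷ b ∷ []) ⟩
        (ka * m + s) + (a + b)       ≡⟨ cong (_+_ (ka * m + s)) a+b≡ ⟩
        (ka * m + s) + (c + e * m)   ≡⟨ solve (ka ∷ m ∷ s ∷ c ∷ e ∷ []) ⟩
        ((e + ka) * m + s) + c       ∎)
      lower : e + ka + kb ≤ kc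
      lower = kunzCoord-least {S} b-coord b<m s∈S shifted

kunzPosetS⇔ : ∀ {S m kv i j} → 1 ≤ i → 1 ≤ j →
  KunzPosetS S m kv i j ⇔ (kv i * m + i ≤ kv j * m + j × S (kv j * m + j ∸ (kv i * m + i)))
kunzPosetS⇔ (s≤s z≤n) (s≤s z≤n) = ⇔-id _

ConeIneq : ℕ → Pt → ℕ → ℕ → Set
ConeIneq m x a b = x ((a + b) mod m) ℚ.≤ x a ℚ.+ x b

module _ {m a b : ℕ} where

  mod-+-comm : (a + b) mod m ≡ (b + a) mod m
  mod-+-comm = cong (_mod m) (+-comm a b)

  validC-sym : ValidC m a b → ValidC m b a
  validC-sym (a∈ , b∈ , ≢0) = b∈ , a∈ , λ eq → ≢0 (trans mod-+-comm eq)

  coneIneq-sym : ∀ {x} → ConeIneq m x a b → ConeIneq m x b a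
  coneIneq-sym {x} = subst₂ ℚ._≤_ (cong x mod-+-comm) (ℚₚ.+-comm (x a) (x b))

  tightC-sym : ∀ {x} → TightC m x a b → TightC m x b a
  tightC-sym {x} t = trans (ℚₚ.+-comm (x b) (x a)) (trans t (cong x mod-+-comm))

kunzPoint : (ℕ → ℕ) → Pt
kunzPoint kv i = ofℕ (kv i)

module Kunz (n : ℕ) where

  m : ℕ
  m = suc n

  frac : ℕ → ℚ
  frac i = + i / m

  frac-+ : ∀ i j → frac i ℚ.+ frac j ≡ frac (i + j)
  frac-+ i j = fraction-sum i j (i + j) n n n (solve (i ∷ j ∷ n ∷ []))

  ofℕ-+-frac : ∀ k i → ofℕ k ℚ.+ frac i ≡ frac (k * m + i)
  ofℕ-+-frac k i = fraction-sum k i (k * m + i) 0 n n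
    (cong₂ _*_ (cong (_+_ (k * m)) (*-identityʳ i)) (sym (*-identityˡ m)))

  frac-carry : ∀ {k} → m ≤ k → frac k ≡ 1ℚ ℚ.+ frac (k ∸ m)
  frac-carry {k} m≤k = sym (trans (ofℕ-+-frac 1 (k ∸ m))
    (cong frac (trans (cong (_+ (k ∸ m)) (*-identityˡ m)) (m+[n∸m]≡n m≤k))))

  frac-injective : ∀ {i j} → frac i ≡ frac j → i ≡ j
  frac-injective {i} {j} eq with ℚₚ./-injective-≃ (mkℚᵘ (+ i) n) (mkℚᵘ (+ j) n) eq
  ... | *≡* e = ℤₚ.+-injective (ℤₚ.*-cancelʳ-≡ (+ i) (+ j) (+ m) e)

  mod-carry : ∀ {i j} → i < m → j < m → m < i + j → (i + j) mod m ≡ i + j ∸ m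
  mod-carry {i} {j} i<m j<m m<i+j = trans (sym (m≤n⇒[n∸m]%m≡n%m (<⇒≤ m<i+j)))
    (m<n⇒m%n≡m (m<n+o⇒m∸n<o (i + j) m (+-mono-< i<m j<m)))

  validP⇒validC : ∀ {i j} → ValidP m i j → ValidC m i j
  validP⇒validC {i} {j} (1≤i , i≤j , j<m , lt⊎gt) =
    (1≤i , ≤-<-trans i≤j j<m) , (≤-trans 1≤i i≤j , j<m) , [ noCarry , carry ] lt⊎gt
    where
    noCarry : i + j < m → (i + j) mod m ≢ 0
    noCarry lt eq = <⇒≢ (≤-trans 1≤i (m≤m+n i j)) (sym (trans (sym (m<n⇒m%n≡m lt)) eq))
    carry : m < i + j → (i + j) mod m ≢ 0
    carry gt eq = <⇒≢ (m<n⇒0<n∸m gt) (sym (trans (sym (mod-carry (≤-<-trans i≤j j<m) j<m gt)) eq))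

  validC⇒validP : ∀ {a b} → ValidC m a b → a ≤ b → ValidP m a b
  validC⇒validP {a} {b} ((1≤a , _) , (_ , b<m) , ≢0) a≤b = 1≤a , a≤b , b<m , noWrap (<-cmp (a + b) m)
    where
    noWrap : Tri (a + b < m) (a + b ≡ m) (m < a + b) → a + b < m ⊎ m < a + b
    noWrap (tri< lt _ _) = inj₁ lt
    noWrap (tri≈ _ eq _) = contradiction (trans (cong (_mod m) eq) (n%n≡0 m)) ≢0
    noWrap (tri> _ _ gt) = inj₂ gt

  validC-wlog : {P : ℕ → ℕ → Set} → (∀ {a b} → P a b → P b a) →
                (∀ {a b} → ValidP m a b → P a b) → ∀ {a b} → ValidC m a b → P a b
  validC-wlog P-sym onValidP {a} {b} v with ≤-total a b
  ... | inj₁ a≤b = onValidP (validC⇒validP v a≤b)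
  ... | inj₂ b≤a = P-sym (onValidP (validC⇒validP (validC-sym v) b≤a))

  -- x = z − v, as a relation: without function extensionality a point agreeing with
  -- minusV m z coordinatewise cannot be identified with it.
  record Shifted (z x : Pt) : Set where
    constructor shifted
    field coordinate : ∀ i → x i ≡ z i ℚ.+ frac i

  minusV-shifted : ∀ z → Shifted z (minusV m z)
  minusV-shifted z = shifted λ i → cong (ℚ._+_ (z i)) (ℚ+.⁻¹-involutive (frac i))

  translate-shifted : ∀ x → Shifted (translate x (vecV m)) x
  translate-shifted x = shifted λ i → sym (ℚ+.//-rightDividesˡ (frac i) (x i))

  module _ {z x : Pt} (z↝x : Shifted z x) where

    open Shifted z↝x

    shifted-+ : ∀ i j → x i ℚ.+ x j ≡ (z i ℚ.+ z j) ℚ.+ frac (i + j)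
    shifted-+ i j = begin
      x i ℚ.+ x j                             ≡⟨ cong₂ ℚ._+_ (coordinate i) (coordinate j) ⟩
      (z i ℚ.+ frac i) ℚ.+ (z j ℚ.+ frac j)   ≡⟨ ℚ+-comm.interchange (z i) (frac i) (z j) (frac j) ⟩
      (z i ℚ.+ z j) ℚ.+ (frac i ℚ.+ frac j)   ≡⟨ cong (ℚ._+_ (z i ℚ.+ z j)) (frac-+ i j) ⟩
      (z i ℚ.+ z j) ℚ.+ frac (i + j)          ∎
      where open ≡-Reasoning

    shifted-+-carry : ∀ i j → m < i + j →
                      x i ℚ.+ x j ≡ ((z i ℚ.+ z j) ℚ.+ 1ℚ) ℚ.+ frac (i + j ∸ m)
    shifted-+-carry i j m<i+j = begin
      x i ℚ.+ x j                                   ≡⟨ shifted-+ i j ⟩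
      (z i ℚ.+ z j) ℚ.+ frac (i + j)
        ≡⟨ cong (ℚ._+_ (z i ℚ.+ z j)) (frac-carry (<⇒≤ m<i+j)) ⟩
      (z i ℚ.+ z j) ℚ.+ (1ℚ ℚ.+ frac (i + j ∸ m))
        ≡⟨ ℚₚ.+-assoc (z i ℚ.+ z j) 1ℚ (frac (i + j ∸ m)) ⟨
      ((z i ℚ.+ z j) ℚ.+ 1ℚ) ℚ.+ frac (i + j ∸ m)
        ∎
      where open ≡-Reasoning

    shifted-mod : ∀ i j → i + j < m → x ((i + j) mod m) ≡ z (i + j) ℚ.+ frac (i + j)
    shifted-mod _ _ lt = trans (cong x (m<n⇒m%n≡m lt)) (coordinate _)

    shifted-mod-carry : ∀ i j → i < m → j < m → m < i + j →
                    x ((i + j) mod m) ≡ z (i + j ∸ m) ℚ.+ frac (i + j ∸ m)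
    shifted-mod-carry _ _ i<m j<m gt = trans (cong x (mod-carry i<m j<m gt)) (coordinate _)

    satP⇔coneIneq : ∀ {i j} → ValidP m i j → SatP m z i j ⇔ ConeIneq m x i j
    satP⇔coneIneq {i} {j} (_ , _ , _ , inj₁ lt) =
      ≤-shift⇔ (shifted-mod i j lt) (shifted-+ i j) ⇔-∘ ×⊎×-selectˡ lt (<⇒≯ lt)
    satP⇔coneIneq {i} {j} (_ , i≤j , j<m , inj₂ gt) =
      ≤-shift⇔ (shifted-mod-carry i j (≤-<-trans i≤j j<m) j<m gt) (shifted-+-carry i j gt)
      ⇔-∘ ×⊎×-selectʳ (<⇒≯ gt) gt

    tightP⇔tightC : ∀ {i j} → ValidP m i j → TightP m z i j ⇔ TightC m x i j
    tightP⇔tightC {i} {j} (_ , _ , _ , inj₁ lt) =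
      ≡-shift⇔ (shifted-+ i j) (shifted-mod i j lt) ⇔-∘ ×⊎×-selectˡ lt (<⇒≯ lt)
    tightP⇔tightC {i} {j} (_ , i≤j , j<m , inj₂ gt) =
      ≡-shift⇔ (shifted-+-carry i j gt) (shifted-mod-carry i j (≤-<-trans i≤j j<m) j<m gt)
      ⇔-∘ ×⊎×-selectʳ (<⇒≯ gt) gt

    kunzPolyhedron⇔groupCone : InKunzPolyhedron m z ⇔ InGroupCone m x
    kunzPolyhedron⇔groupCone = mk⇔
      (λ z∈P a b → validC-wlog {ConeIneq m x} (coneIneq-sym {x = x})
                                 (λ v → satP⇔coneIneq v .to (z∈P _ _ v)))
      (λ x∈C i j v → satP⇔coneIneq v .from (x∈C i j (validP⇒validC v)))

  -- An equality of P_m indexed by i ≤ j becomes the cone equality for both (i , j) and (j , i).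
  symmetrized : (ℕ → ℕ → Set) → ℕ → ℕ → Set
  symmetrized T a b = (ValidP m a b × T a b) ⊎ (ValidP m b a × T b a)

  module _ {z x : Pt} (z↝x : Shifted z x) (T : ℕ → ℕ → Set) where

    tightOn⇔ : (∀ i j → ValidP m i j → T i j → TightP m z i j)
             ⇔ (∀ a b → ValidC m a b → symmetrized T a b → TightC m x a b)
    tightOn⇔ = mk⇔
      (λ tight a b _ → [ (λ (v , t) → tightP⇔tightC z↝x v .to (tight a b v t))
                       , (λ (v , t) → tightC-sym {x = x} (tightP⇔tightC z↝x v .to (tight b a v t))) ])
      (λ tight i j v t → tightP⇔tightC z↝x v .from (tight i j (validP⇒validC v) (inj₁ (v , t))))

  module _ {F : Pt → Set} (F-face : IsFaceP m F) where

    face⇔ : ∀ {z x} → Shifted z x →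
            F z ⇔ (InGroupCone m x
                   × (∀ a b → ValidC m a b → symmetrized (proj₁ F-face) a b → TightC m x a b))
    face⇔ {z} z↝x = (kunzPolyhedron⇔groupCone z↝x ×-⇔ tightOn⇔ z↝x (proj₁ F-face)) ⇔-∘ proj₂ F-face z

    shiftFace-isFaceC : IsFaceC m (shiftFace m F)
    shiftFace-isFaceC = symmetrized (proj₁ F-face) , λ x → face⇔ (translate-shifted x)

    minusV∈shiftFace : ∀ {z} → F z → shiftFace m F (minusV m z)
    minusV∈shiftFace {z} z∈F =
      face⇔ (translate-shifted (minusV m z)) .from (face⇔ (minusV-shifted z) .to z∈F)

    relInt-tight⇔ : ∀ {z a b} → InRelIntP m F z → ValidC m a b →
                    (∀ x → shiftFace m F x → TightC m x a b) ⇔ TightC m (minusV m z) a b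
    relInt-tight⇔ {z} (z∈F , rigid) v =
      mk⇔ (λ tight → tight (minusV m z) (minusV∈shiftFace {z} z∈F))
      (λ t x x∈F' → validC-wlog {λ a b → TightC m (minusV m z) a b → TightC m x a b}
        (λ f t → tightC-sym {x = x} (f (tightC-sym {x = minusV m z} t)))
        (λ {i} {j} v t → tightP⇔tightC (translate-shifted x) v .to
           (rigid i j v (tightP⇔tightC (minusV-shifted z) v .from t) _ x∈F'))
        v t)

  minusV-kunzPoint : ∀ kv i → minusV m (kunzPoint kv) i ≡ frac (kv i * m + i)
  minusV-kunzPoint kv i =
    trans (Shifted.coordinate (minusV-shifted (kunzPoint kv)) i) (ofℕ-+-frac (kv i) i)

  tightC-kunzPoint⇔ : ∀ kv a b → let c = (a + b) mod m in
    TightC m (minusV m (kunzPoint kv)) a b ⇔ ((kv a * m + a) + (kv b * m + b) ≡ kv c * m + c)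
  tightC-kunzPoint⇔ kv a b = mk⇔
    (λ t → frac-injective (trans (sym sum≡) (trans t (minusV-kunzPoint kv c))))
    (λ eq → trans sum≡ (trans (cong frac eq) (sym (minusV-kunzPoint kv c))))
    where
    c = (a + b) mod m
    sum≡ : minusV m (kunzPoint kv) a ℚ.+ minusV m (kunzPoint kv) b
         ≡ frac ((kv a * m + a) + (kv b * m + b))
    sum≡ = trans (cong₂ ℚ._+_ (minusV-kunzPoint kv a) (minusV-kunzPoint kv b))
                 (frac-+ (kv a * m + a) (kv b * m + b))

  kunzSubgroup-trivial : ∀ {F' kv h} → F' (minusV m (kunzPoint kv)) → ¬ InKunzSubgroupNZ m F' h
  kunzSubgroup-trivial {kv = kv} {h} xk∈F' ((1≤h , _) , vanishes) =
    <⇒≢ (≤-trans 1≤h (m≤n+m h (kv h * m))) (sym apery≡0)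
    where
    apery≡0 : kv h * m + h ≡ 0
    apery≡0 = frac-injective (trans (sym (minusV-kunzPoint kv h))
                                    (trans (vanishes _ xk∈F') (sym (ℚₚ.0/n≡0 m))))

  module _ {S : ℕ → Set} (S-closed : ∀ s t → S s → S t → S (s + t))
           {kv : ℕ → ℕ} (kv-kunz : IsKunzVector S m kv) where

    apery-sum⇔kunzPoset : ∀ {a b} → ValidC m a b → let c = (a + b) mod m in
      ((kv a * m + a) + (kv b * m + b) ≡ kv c * m + c) ⇔ KunzPosetS S m kv a c
    apery-sum⇔kunzPoset {a} {b} (a∈@(1≤a , _) , b∈@(_ , b<m) , c≢0) =
      ⇔-sym (kunzPosetS⇔ {S} {m} {kv} 1≤a (n≢0⇒n>0 c≢0))
      ⇔-∘ kunzCoord-sum⇔ S-closed {e = (a + b) ℕ./ m}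
            (kv-kunz a a∈) (kv-kunz b b∈) (kv-kunz ((a + b) mod m) c∈) b<m (proj₂ c∈)
            (m≡m%n+[m/n]*n (a + b) m)
      where
      c∈ : InRange m ((a + b) mod m)
      c∈ = n≢0⇒n>0 c≢0 , m%n<n (a + b) m

    kunzPoset-shiftFace : ∀ {F} → IsFaceP m F → InRelIntP m F (kunzPoint kv) →
                          IsKunzPosetOfFace m (shiftFace m F) (KunzPosetS S m kv)
    kunzPoset-shiftFace F-face relInt@(kp∈F , _) =
      (λ _ → kunzSubgroup-trivial {kv = kv} (minusV∈shiftFace F-face {kunzPoint kv} kp∈F))
      , λ a b v → apery-sum⇔kunzPoset v
                  ⇔-∘ (tightC-kunzPoint⇔ kv a b ⇔-∘ relInt-tight⇔ F-face relInt v)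

theorem4p7 : (m : ℕ) → 2 ≤ m →
    (∀ z → InKunzPolyhedron m z ⇔ InGroupCone m (minusV m z))
    × (∀ (F : Pt → Set) → IsFaceP m F →
         ∀ (S : ℕ → Set) → IsNumericalSemigroup S → S m →
         ∀ (kv : ℕ → ℕ) → IsKunzVector S m kv →
         InRelIntP m F (λ i → ofℕ (kv i)) →
         IsFaceC m (shiftFace m F) × IsKunzPosetOfFace m (shiftFace m F) (KunzPosetS S m kv))
theorem4p7 (suc n) _ =
  (λ z → kunzPolyhedron⇔groupCone (minusV-shifted z))
  , λ F F-face S S-semigroup _ kv kv-kunz relInt →
      shiftFace-isFaceC F-face
      , kunzPoset-shiftFace (IsNumericalSemigroup.+-closed S-semigroup) kv-kunz F-face relInt
  where open Kunz n
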